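{- Let $\xi\star\pi\in\perp\!\!\!\perp$. Then: (i) if $\xi'\star\pi'$ is obtained from $\xi\star\pi$ by substituting arbitrary terms for the non-efficient occurrences of $\mathsf p$, then $\xi'\star\pi'\in\perp\!\!\!\perp$; (ii) if $\xi'\star\pi'$ is obtained from $\xi\star\pi$ by substituting $\mathsf q_0$ for the efficient occurrence of $\mathsf p$ and arbitrary terms for the non-efficient occurrences of $\mathsf p$, then $\xi'\star\pi'\succ\mathsf q_0\star\varpi$ for some stack $\varpi$, and in particular $\xi'\star\pi'\notin\perp\!\!\!\perp$.
   Context: Fix an integer $N\ge 0$. The BBC realizability algebra $(\Lambda,\Pi,\perp\!\!\!\perp)$: terms $\Lambda$ form the smallest set containing constants $\mathsf B,\mathsf C,\mathsf I,\mathsf K,\mathsf W,\mathsf{cc},\mathsf A$ and $\mathsf p,\mathsf q_0,\dots,\mathsf q_N$, closed under application $(\xi)\eta$, and such that to every sequence $(\xi_i)_{i\in\mathbb N}$ of closed terms (no occurrence of $\mathsf p,\mathsf q_0,\dots,\mathsf q_N$) is associated injectively and well-foundedly a new constant $\bigwedge_i\xi_i$. Each term is a finite string of constants and parentheses; occurrences refer to this string. Stacks: $t_0\cdot\ldots\cdot t_{n-1}\cdot\pi_0$, $\pi_0$ the empty stack. Continuations $\mathsf k_{\pi_0}=\mathsf A$, $\mathsf k_{t\cdot\pi}=(\ell_t)\mathsf k_\pi$, $\ell_t=((\mathsf C)(\mathsf B)\mathsf C\mathsf B)t$; integers $\underline 0=(\mathsf K)\mathsf I$, $\underline{n+1}=(\sigma)\underline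 n$, $\sigma=(\mathsf B\mathsf W)(\mathsf C)(\mathsf B)\mathsf B\mathsf B$. One-step execution rules: (1) $(\xi)\eta\star\pi\succ\xi\star\eta\cdot\pi$; (2) $\mathsf B\star\xi\cdot\eta\cdot\zeta\cdot\pi\succ\xi\star(\eta)\zeta\cdot\pi$; (3) $\mathsf C\star\xi\cdot\eta\cdot\zeta\cdot\pi\succ\xi\star\zeta\cdot\eta\cdot\pi$; (4) $\mathsf I\star\xi\cdot\pi\succ\xi\star\pi$; (5) $\mathsf K\star\xi\cdot\eta\cdot\pi\succ\xi\star\pi$; (6) $\mathsf W\star\xi\cdot\eta\cdot\pi\succ\xi\star\eta\cdot\eta\cdot\pi$; (7) $\mathsf{cc}\star\xi\cdot\pi\succ\xi\star\mathsf k_\pi\cdot\pi$; (8) $\mathsf A\star\xi\cdot\pi\succ\xi\star\pi_0$; (9) $\bigwedge_i\xi_i\star\underline n\cdot\pi\succ\xi_n\star\pi$; execution $\succ$ is the least preorder containing them; at most one rule applies to a process, so execution is deterministic. Pole $\perp\!\!\!\perp=\{\xi\star\pi:\exists\varpi,\ \xi\star\pi\succ\mathsf p\star\varpi\}$. Efficient occurrence: for $\xi\star\pi\in\perp\!\!\!\perp$, an occurrence of $\mathsf p$ in $\xi\star\pi$ is singled out by recursion on the length of the execution leading to a process with head $\mathsf p$: if $\xi=\mathsf p$, it is this head occurrence; otherwise $\xi\star\pi$ executes in one step (by one of the rules above) to a process $\xi_1\star\pi_1\in\perp\!\!\!\perp$, each occurrence of $\mathsf p$ in $\xi_1\star\pi_1$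 being a copy of a unique occurrence of $\mathsf p$ in $\xi\star\pi$ (e.g. an occurrence inside $\mathsf k_\pi$ after rule (7) corresponds to the occurrence in $\pi$ it was copied from), and the efficient occurrence of $\xi\star\pi$ is the occurrence corresponding to the efficient occurrence of $\xi_1\star\pi_1$. All other occurrences of $\mathsf p$ are non-efficient. -}

module Defs where

open import Data.Nat using (ℕ; zero; suc)
open import Data.Fin using (Fin)
open import Data.Empty using (⊥; ⊥-elim)
open import Data.Sum using (_⊎_; inj₁; inj₂)
open import Data.Product using (∃; _,_)
open import Data.List using (List; []; _∷_)
open import Relation.Binary.Construct.Closure.ReflexiveTransitive using (Star)

-- Terms over a set X of extra atoms.
-- Closed terms (no p, q_i) are Tm ⊥.  The constant ⋀ f is a constructor
-- taking a sequence of closed terms (injective and well-founded by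
-- construction).

data Tm (X : Set) : Set where
  `B `C `I `K `W `cc `A : Tm X
  at : X → Tm X
  ap : Tm X → Tm X → Tm X
  ⋀  : (ℕ → Tm ⊥) → Tm X

mapT : {X Y : Set} → (X → Y) → Tm X → Tm Y
mapT f `B = `B
mapT f `C = `C
mapT f `I = `I
mapT f `K = `K
mapT f `W = `W
mapT f `cc = `cc
mapT f `A = `A
mapT f (at x) = at (f x)
mapT f (ap t u) = ap (mapT f t) (mapT f u)
mapT f (⋀ g) = ⋀ g

closed : {X : Set} → Tm ⊥ → Tm X
closed = mapT ⊥-elim

Stack : Set → Set
Stack X = List (Tm X)

record Proc (X : Set) : Set where
  constructor _⋆_
  field
    head  : Tm X
    stack : Stack X

infix 4 _⋆_

ℓ : {X : Set} → Tm X → Tm X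
ℓ t = ap (ap `C (ap (ap `B `C) `B)) t

kont : {X : Set} → Stack X → Tm X
kont [] = `A
kont (t ∷ π) = ap (ℓ t) (kont π)

σ : {X : Set} → Tm X
σ = ap (ap `B `W) (ap `C (ap (ap `B `B) `B))

num : {X : Set} → ℕ → Tm X
num zero = ap `K `I
num (suc n) = ap σ (num n)

data _↦_ {X : Set} : Proc X → Proc X → Set where
  r-app : ∀ {ξ η π} → (ap ξ η ⋆ π) ↦ (ξ ⋆ η ∷ π)
  r-B   : ∀ {ξ η ζ π} → (`B ⋆ ξ ∷ η ∷ ζ ∷ π) ↦ (ξ ⋆ ap η ζ ∷ π)
  r-C   : ∀ {ξ η ζ π} → (`C ⋆ ξ ∷ η ∷ ζ ∷ π) ↦ (ξ ⋆ ζ ∷ η ∷ π)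
  r-I   : ∀ {ξ π} → (`I ⋆ ξ ∷ π) ↦ (ξ ⋆ π)
  r-K   : ∀ {ξ η π} → (`K ⋆ ξ ∷ η ∷ π) ↦ (ξ ⋆ π)
  r-W   : ∀ {ξ η π} → (`W ⋆ ξ ∷ η ∷ π) ↦ (ξ ⋆ η ∷ η ∷ π)
  r-cc  : ∀ {ξ π} → (`cc ⋆ ξ ∷ π) ↦ (ξ ⋆ kont π ∷ π)
  r-A   : ∀ {ξ π} → (`A ⋆ ξ ∷ π) ↦ (ξ ⋆ [])
  r-⋀   : ∀ {f n π} → (⋀ f ⋆ num n ∷ π) ↦ (closed (f n) ⋆ π)

_≻_ : {X : Set} → Proc X → Proc X → Set
_≻_ = Star _↦_

data Atom (N : ℕ) : Set where
  p : Atom N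
  q : Fin (suc N) → Atom N

Λ : ℕ → Set
Λ N = Tm (Atom N)

_∈⊥⊥ : {N : ℕ} → Proc (Atom N) → Set
P ∈⊥⊥ = ∃ λ ϖ → P ≻ (at p ⋆ ϖ)

-- Occurrences of p (positions in the finite string; closed subterms
-- under ⋀ contain no p).

data OccT {N : ℕ} : Tm (Atom N) → Set where
  here  : OccT (at p)
  left  : ∀ {t u} → OccT t → OccT (ap t u)
  right : ∀ {t u} → OccT u → OccT (ap t u)

data OccS {N : ℕ} : Stack (Atom N) → Set where
  top  : ∀ {t π} → OccT t → OccS (t ∷ π)
  rest : ∀ {t π} → OccS π → OccS (t ∷ π)

OccP : {N : ℕ} → Proc (Atom N) → Set
OccP (ξ ⋆ π) = OccT ξ ⊎ OccS π

substT : {N : ℕ} (t : Tm (Atom N)) → (OccT t → Tm (Atom N)) → Tm (Atom N)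
substT `B g = `B
substT `C g = `C
substT `I g = `I
substT `K g = `K
substT `W g = `W
substT `cc g = `cc
substT `A g = `A
substT (at p) g = g here
substT (at (q i)) g = at (q i)
substT (ap t u) g = ap (substT t (λ o → g (left o))) (substT u (λ o → g (right o)))
substT (⋀ f) g = ⋀ f

substS : {N : ℕ} (π : Stack (Atom N)) → (OccS π → Tm (Atom N)) → Stack (Atom N)
substS [] g = []
substS (t ∷ π) g = substT t (λ o → g (top o)) ∷ substS π (λ o → g (rest o))

substP : {N : ℕ} (P : Proc (Atom N)) → (OccP P → Tm (Atom N)) → Proc (Atom N)
substP (ξ ⋆ π) g = substT ξ (λ o → g (inj₁ o)) ⋆ substS π (λ o → g (inj₂ o))

-- Executing the labelled process
-- tracks which original occurrence every copy of p comes from.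
labT : {N : ℕ} {O : Set} (t : Tm (Atom N)) → (OccT t → O) → Tm (Atom N ⊎ O)
labT `B g = `B
labT `C g = `C
labT `I g = `I
labT `K g = `K
labT `W g = `W
labT `cc g = `cc
labT `A g = `A
labT (at p) g = at (inj₂ (g here))
labT (at (q i)) g = at (inj₁ (q i))
labT (ap t u) g = ap (labT t (λ o → g (left o))) (labT u (λ o → g (right o)))
labT (⋀ f) g = ⋀ f

labS : {N : ℕ} {O : Set} (π : Stack (Atom N)) → (OccS π → O) → Stack (Atom N ⊎ O)
labS [] g = []
labS (t ∷ π) g = labT t (λ o → g (top o)) ∷ labS π (λ o → g (rest o))

labP : {N : ℕ} (P : Proc (Atom N)) → Proc (Atom N ⊎ OccP P)
labP (ξ ⋆ π) = labT ξ inj₁ ⋆ labS π inj₂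

Efficient : {N : ℕ} (P : Proc (Atom N)) → OccP P → Set
Efficient P e = ∃ λ ϖ → labP P ≻ (at (inj₂ e) ⋆ ϖ)

module Submission where

-- Label every occurrence o of p in P by a fresh inert atom
-- inj₂ o; this gives the labelled process labP P.  Two substitutions send
-- labP P back to ordinary processes: erasing all labels to p gives P, and
-- instantiating each label o by g o gives substP P g.  Everything rests on
-- three general facts about execution over an arbitrary set of atoms:
--   (1) substitution of terms for atoms is a simulation: if Q ≻ R then
--       Q[h] ≻ R[h];
--   (2) execution is deterministic, so a process reaches at most one
--       atom-headed process, and in particular at most one head atom;
--   (3) renaming of atoms reflects execution: if Q[f] reaches a process
--       with head atom z, then Q reaches a process whose head atom y has
--       f y ≡ z.
-- By (3) applied to the erasure, the labelled execution of P ∈ ⊥⊥ reaches a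
-- label, i.e. an efficient occurrence exists.  By (1) applied to the
-- instantiation, substP P g reaches g e for the efficient occurrence e;
-- this gives both (i) and the execution in (ii), and (2) shows that a
-- process reaching q₀ cannot also reach p.

open import Defs
open import Data.Nat using (ℕ)
open import Data.Fin using (zero)
open import Data.Product using (Σ; ∃; _×_)
open import Relation.Binary.PropositionalEquality using (_≡_)
open import Relation.Nullary using (¬_)

open import Data.Nat using (zero; suc)
open import Data.Fin using (Fin)
open import Data.Empty using (⊥; ⊥-elim)
open import Data.Maybe using (Maybe; just; nothing; zipWith)
open import Data.Sum using (_⊎_; inj₁; inj₂; [_,_])
open import Data.Product using (_,_)
open import Data.List using ([]; _∷_)
open import Relation.Binary.PropositionalEquality
  using (refl; sym; trans; cong; cong₂; subst; module ≡-Reasoning)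
open import Relation.Binary.Construct.Closure.ReflexiveTransitive using (ε; _◅_)

bindT : {X Y : Set} → (X → Tm Y) → Tm X → Tm Y
bindT h `B = `B
bindT h `C = `C
bindT h `I = `I
bindT h `K = `K
bindT h `W = `W
bindT h `cc = `cc
bindT h `A = `A
bindT h (at x) = h x
bindT h (ap t u) = ap (bindT h t) (bindT h u)
bindT h (⋀ g) = ⋀ g

bindS : {X Y : Set} → (X → Tm Y) → Stack X → Stack Y
bindS h [] = []
bindS h (t ∷ π) = bindT h t ∷ bindS h π

bindP : {X Y : Set} → (X → Tm Y) → Proc X → Proc Y
bindP h (t ⋆ π) = bindT h t ⋆ bindS h π

renameT : {X Y : Set} → (X → Y) → Tm X → Tm Y
renameT f = bindT (λ x → at (f x))

renameP : {X Y : Set} → (X → Y) → Proc X → Proc Y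
renameP f = bindP (λ x → at (f x))

-- (1) Substitution is a simulation.

-- Continuations, closed terms and numerals are built without atoms, hence
-- commute with (or are fixed by) substitution.
bind-kont : {X Y : Set} (h : X → Tm Y) (π : Stack X) →
  bindT h (kont π) ≡ kont (bindS h π)
bind-kont h [] = refl
bind-kont h (t ∷ π) = cong (ap (ℓ (bindT h t))) (bind-kont h π)

bind-closed : {X Y : Set} (h : X → Tm Y) (c : Tm ⊥) → bindT h (closed c) ≡ closed c
bind-closed h `B = refl
bind-closed h `C = refl
bind-closed h `I = refl
bind-closed h `K = refl
bind-closed h `W = refl
bind-closed h `cc = refl
bind-closed h `A = refl
bind-closed h (at ())
bind-closed h (ap t u) = cong₂ ap (bind-closed h t) (bind-closed h u)
bind-closed h (⋀ g) = refl

bind-num : {X Y : Set} (h : X → Tm Y) (n : ℕ) → bindT h (num n) ≡ num n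
bind-num h zero = refl
bind-num h (suc n) = cong (ap σ) (bind-num h n)

bind-step : {X Y : Set} (h : X → Tm Y) {Q R : Proc X} → Q ↦ R → bindP h Q ↦ bindP h R
bind-step h r-app = r-app
bind-step h r-B = r-B
bind-step h r-C = r-C
bind-step h r-I = r-I
bind-step h r-K = r-K
bind-step h r-W = r-W
bind-step h (r-cc {π = π}) rewrite bind-kont h π = r-cc
bind-step h r-A = r-A
bind-step h (r-⋀ {f} {n}) rewrite bind-num h n | bind-closed h (f n) = r-⋀

bind-exec : {X Y : Set} (h : X → Tm Y) {Q R : Proc X} → Q ≻ R → bindP h Q ≻ bindP h R
bind-exec h ε = ε
bind-exec h (s ◅ ss) = bind-step h s ◅ bind-exec h ss

-- (2) Determinism.

ap-injectiveʳ : {X : Set} {t t′ u u′ : Tm X} → ap t u ≡ ap t′ u′ → u ≡ u′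
ap-injectiveʳ refl = refl

num-injective : {X : Set} (m n : ℕ) → num {X} m ≡ num n → m ≡ n
num-injective zero zero eq = refl
num-injective (suc m) (suc n) eq = cong suc (num-injective m n (ap-injectiveʳ eq))
num-injective zero (suc n) ()
num-injective (suc m) zero ()

-- Rule (9) is the only rule whose left-hand side is not a constructor
-- pattern; its result is determined by the numeral on the stack.
⋀-step-result : {X : Set} {f : ℕ → Tm ⊥} {x : Tm X} {π : Stack X} {R : Proc X}
  (n : ℕ) → x ≡ num n → (⋀ f ⋆ x ∷ π) ↦ R → R ≡ (closed (f n) ⋆ π)
⋀-step-result {f = f} {π = π} n eq (r-⋀ {n = m}) =
  cong (λ k → closed (f k) ⋆ π) (num-injective m n eq)

step-deterministic : {X : Set} {Q R R′ : Proc X} → Q ↦ R → Q ↦ R′ → R ≡ R′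
step-deterministic r-app r-app = refl
step-deterministic r-B r-B = refl
step-deterministic r-C r-C = refl
step-deterministic r-I r-I = refl
step-deterministic r-K r-K = refl
step-deterministic r-W r-W = refl
step-deterministic r-cc r-cc = refl
step-deterministic r-A r-A = refl
step-deterministic (r-⋀ {n = n}) s = sym (⋀-step-result n refl s)

atom-stuck : {X : Set} {x : X} {ϖ : Stack X} {R : Proc X} → ¬ ((at x ⋆ ϖ) ↦ R)
atom-stuck ()

exec-towards-atom : {X : Set} {Q R : Proc X} {x : X} {ϖ : Stack X} →
  Q ≻ R → Q ≻ (at x ⋆ ϖ) → R ≻ (at x ⋆ ϖ)
exec-towards-atom ε r = r
exec-towards-atom (s ◅ ss) ε = ⊥-elim (atom-stuck s)
exec-towards-atom (s ◅ ss) (s′ ◅ ss′) with step-deterministic s s′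
... | refl = exec-towards-atom ss ss′

reached-atom-unique : {X : Set} {Q : Proc X} {x y : X} {ϖ ϖ′ : Stack X} →
  Q ≻ (at x ⋆ ϖ) → Q ≻ (at y ⋆ ϖ′) → x ≡ y
reached-atom-unique r r′ with exec-towards-atom r r′
... | ε = refl
... | s ◅ _ = ⊥-elim (atom-stuck s)

-- (3) Renaming reflects execution.

closedPart : {X : Set} → Tm X → Maybe (Tm ⊥)
closedPart `B = just `B
closedPart `C = just `C
closedPart `I = just `I
closedPart `K = just `K
closedPart `W = just `W
closedPart `cc = just `cc
closedPart `A = just `A
closedPart (at x) = nothing
closedPart (ap t u) = zipWith ap (closedPart t) (closedPart u)
closedPart (⋀ g) = just (⋀ g)

closedPart-closed : {X : Set} (c : Tm ⊥) → closedPart {X} (closed c) ≡ just c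
closedPart-closed `B = refl
closedPart-closed `C = refl
closedPart-closed `I = refl
closedPart-closed `K = refl
closedPart-closed `W = refl
closedPart-closed `cc = refl
closedPart-closed `A = refl
closedPart-closed (at ())
closedPart-closed (ap c d) =
  cong₂ (zipWith ap) (closedPart-closed c) (closedPart-closed d)
closedPart-closed (⋀ g) = refl

closedPart-sound : {X : Set} (t : Tm X) {c : Tm ⊥} → closedPart t ≡ just c → t ≡ closed c
closedPart-sound `B refl = refl
closedPart-sound `C refl = refl
closedPart-sound `I refl = refl
closedPart-sound `K refl = refl
closedPart-sound `W refl = refl
closedPart-sound `cc refl = refl
closedPart-sound `A refl = refl
closedPart-sound (at x) ()
closedPart-sound (ap t u) eq with closedPart t in et | closedPart u in eu
closedPart-sound (ap t u) refl | just _ | just _ =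
  cong₂ ap (closedPart-sound t et) (closedPart-sound u eu)
closedPart-sound (ap t u) () | just _ | nothing
closedPart-sound (ap t u) () | nothing | _
closedPart-sound (⋀ g) refl = refl

closedPart-rename : {X Y : Set} (f : X → Y) (t : Tm X) →
  closedPart (renameT f t) ≡ closedPart t
closedPart-rename f `B = refl
closedPart-rename f `C = refl
closedPart-rename f `I = refl
closedPart-rename f `K = refl
closedPart-rename f `W = refl
closedPart-rename f `cc = refl
closedPart-rename f `A = refl
closedPart-rename f (at x) = refl
closedPart-rename f (ap t u) =
  cong₂ (zipWith ap) (closedPart-rename f t) (closedPart-rename f u)
closedPart-rename f (⋀ g) = refl

rename-reflects-closed : {X Y : Set} (f : X → Y) (t : Tm X) (c : Tm ⊥) →
  renameT f t ≡ closed c → t ≡ closed c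
rename-reflects-closed f t c eq = closedPart-sound t (begin
  closedPart t                ≡⟨ sym (closedPart-rename f t) ⟩
  closedPart (renameT f t)    ≡⟨ cong closedPart eq ⟩
  closedPart (closed c)       ≡⟨ closedPart-closed c ⟩
  just c                      ∎)
  where open ≡-Reasoning

num-closed : {X : Set} (n : ℕ) → num {X} n ≡ closed (num n)
num-closed zero = refl
num-closed (suc n) = cong (ap σ) (num-closed n)

rename-reflects-num : {X Y : Set} (f : X → Y) (t : Tm X) (n : ℕ) →
  renameT f t ≡ num n → t ≡ num n
rename-reflects-num f t n eq =
  trans (rename-reflects-closed f t (num n) (trans eq (num-closed n))) (sym (num-closed n))

rename-reflects-atom : {X Y : Set} (f : X → Y) (t : Tm X) {z : Y} →
  renameT f t ≡ at z → ∃ λ x → t ≡ at x × f x ≡ z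
rename-reflects-atom f (at x) refl = x , refl , refl
rename-reflects-atom f `B ()
rename-reflects-atom f `C ()
rename-reflects-atom f `I ()
rename-reflects-atom f `K ()
rename-reflects-atom f `W ()
rename-reflects-atom f `cc ()
rename-reflects-atom f `A ()
rename-reflects-atom f (ap _ _) ()
rename-reflects-atom f (⋀ _) ()

⋀-step-num : {X : Set} {g : ℕ → Tm ⊥} {t : Tm X} {π : Stack X} {R : Proc X} →
  (⋀ g ⋆ t ∷ π) ↦ R → ∃ λ n → t ≡ num n
⋀-step-num (r-⋀ {n = n}) = n , refl

-- If the renamed process can step, so can the original one: a rule applies
-- according to the head constant and the length of the stack, which
-- renaming preserves, and for rule (9) the argument is a numeral.
rename-progress : {X Y : Set} (f : X → Y) (Q : Proc X) {M : Proc Y} →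
  renameP f Q ↦ M → ∃ λ Q′ → Q ↦ Q′
rename-progress f (ap t u ⋆ π) s = _ , r-app
rename-progress f (`B ⋆ _ ∷ _ ∷ _ ∷ π) s = _ , r-B
rename-progress f (`C ⋆ _ ∷ _ ∷ _ ∷ π) s = _ , r-C
rename-progress f (`I ⋆ _ ∷ π) s = _ , r-I
rename-progress f (`K ⋆ _ ∷ _ ∷ π) s = _ , r-K
rename-progress f (`W ⋆ _ ∷ _ ∷ π) s = _ , r-W
rename-progress f (`cc ⋆ _ ∷ π) s = _ , r-cc
rename-progress f (`A ⋆ _ ∷ π) s = _ , r-A
rename-progress f (⋀ g ⋆ t ∷ π) s with ⋀-step-num s
... | n , eq with rename-reflects-num f t n eq
... | refl = _ , r-⋀
rename-progress f (at x ⋆ π) s = ⊥-elim (atom-stuck s)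
rename-progress f (`B ⋆ []) ()
rename-progress f (`B ⋆ _ ∷ []) ()
rename-progress f (`B ⋆ _ ∷ _ ∷ []) ()
rename-progress f (`C ⋆ []) ()
rename-progress f (`C ⋆ _ ∷ []) ()
rename-progress f (`C ⋆ _ ∷ _ ∷ []) ()
rename-progress f (`I ⋆ []) ()
rename-progress f (`K ⋆ []) ()
rename-progress f (`K ⋆ _ ∷ []) ()
rename-progress f (`W ⋆ []) ()
rename-progress f (`W ⋆ _ ∷ []) ()
rename-progress f (`cc ⋆ []) ()
rename-progress f (`A ⋆ []) ()
rename-progress f (⋀ g ⋆ []) ()

-- By determinism, the step found by progress is the renamed step.
rename-reflects-step : {X Y : Set} (f : X → Y) (Q : Proc X) {M : Proc Y} →
  renameP f Q ↦ M → ∃ λ Q′ → Q ↦ Q′ × renameP f Q′ ≡ M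
rename-reflects-step f Q s with rename-progress f Q s
... | Q′ , s′ = Q′ , s′ , step-deterministic (bind-step (λ x → at (f x)) s′) s

-- Stated for any M equal to the renamed process, so that the empty
-- execution can be matched.
rename-reflects-exec : {X Y : Set} (f : X → Y) (Q : Proc X) {M : Proc Y} {z : Y}
  {ϖ : Stack Y} → renameP f Q ≡ M → M ≻ (at z ⋆ ϖ) →
  ∃ λ x → f x ≡ z × ∃ λ ϖ′ → Q ≻ (at x ⋆ ϖ′)
rename-reflects-exec f (t ⋆ π) eq ε with rename-reflects-atom f t (cong Proc.head eq)
... | x , refl , fx≡z = x , fx≡z , π , ε
rename-reflects-exec f Q refl (s ◅ ss) with rename-reflects-step f Q s
... | Q′ , s′ , refl with rename-reflects-exec f Q′ refl ss
... | x , fx≡z , ϖ′ , r = x , fx≡z , ϖ′ , s′ ◅ r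

bind-labT : {N : ℕ} {O : Set} (h : Atom N ⊎ O → Λ N) →
  (∀ i → h (inj₁ (q i)) ≡ at (q i)) → (t : Λ N) (k : OccT t → O) →
  bindT h (labT t k) ≡ substT t (λ o → h (inj₂ (k o)))
bind-labT h h-q `B k = refl
bind-labT h h-q `C k = refl
bind-labT h h-q `I k = refl
bind-labT h h-q `K k = refl
bind-labT h h-q `W k = refl
bind-labT h h-q `cc k = refl
bind-labT h h-q `A k = refl
bind-labT h h-q (at p) k = refl
bind-labT h h-q (at (q i)) k = h-q i
bind-labT h h-q (ap t u) k =
  cong₂ ap (bind-labT h h-q t (λ o → k (left o))) (bind-labT h h-q u (λ o → k (right o)))
bind-labT h h-q (⋀ g) k = refl

bind-labS : {N : ℕ} {O : Set} (h : Atom N ⊎ O → Λ N) →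
  (∀ i → h (inj₁ (q i)) ≡ at (q i)) → (π : Stack (Atom N)) (k : OccS π → O) →
  bindS h (labS π k) ≡ substS π (λ o → h (inj₂ (k o)))
bind-labS h h-q [] k = refl
bind-labS h h-q (t ∷ π) k =
  cong₂ _∷_ (bind-labT h h-q t (λ o → k (top o))) (bind-labS h h-q π (λ o → k (rest o)))

bind-labP : {N : ℕ} (P : Proc (Atom N)) (h : Atom N ⊎ OccP P → Λ N) →
  (∀ i → h (inj₁ (q i)) ≡ at (q i)) → bindP h (labP P) ≡ substP P (λ o → h (inj₂ o))
bind-labP (ξ ⋆ π) h h-q = cong₂ _⋆_ (bind-labT h h-q ξ inj₁) (bind-labS h h-q π inj₂)

substT-p : {N : ℕ} (t : Λ N) → substT t (λ _ → at p) ≡ t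
substT-p `B = refl
substT-p `C = refl
substT-p `I = refl
substT-p `K = refl
substT-p `W = refl
substT-p `cc = refl
substT-p `A = refl
substT-p (at p) = refl
substT-p (at (q i)) = refl
substT-p (ap t u) = cong₂ ap (substT-p t) (substT-p u)
substT-p (⋀ g) = refl

substS-p : {N : ℕ} (π : Stack (Atom N)) → substS π (λ _ → at p) ≡ π
substS-p [] = refl
substS-p (t ∷ π) = cong₂ _∷_ (substT-p t) (substS-p π)

-- Erasing the labels back to p.  The atom inj₁ p never occurs in a
-- labelled process; sending it to q₀ makes the labels the only atoms
-- erased to p.
erase : {N : ℕ} {O : Set} → Atom N ⊎ O → Atom N
erase (inj₁ p) = q zero
erase (inj₁ (q i)) = q i
erase (inj₂ _) = p

erase-label : {N : ℕ} (P : Proc (Atom N)) → renameP erase (labP P) ≡ P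
erase-label (ξ ⋆ π) =
  trans (bind-labP (ξ ⋆ π) (λ x → at (erase x)) (λ i → refl))
        (cong₂ _⋆_ (substT-p ξ) (substS-p π))

q≢p : {N : ℕ} {i : Fin (suc N)} → ¬ (q i ≡ p)
q≢p ()

-- A process in the pole has an efficient occurrence of p: erasing the
-- labels reflects the execution of P to p into one of labP P to a label.
efficient-exists : {N : ℕ} (P : Proc (Atom N)) → P ∈⊥⊥ → Σ (OccP P) (Efficient P)
efficient-exists P (_ , r) with rename-reflects-exec erase (labP P) (erase-label P) r
... | inj₂ o , refl , ϖ′ , r′ = o , ϖ′ , r′
... | inj₁ p , q₀≡p , _ = ⊥-elim (q≢p q₀≡p)
... | inj₁ (q i) , qᵢ≡p , _ = ⊥-elim (q≢p qᵢ≡p)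

-- Substituting g into P leads to a process with head g e, e efficient:
-- instantiate the labels in the labelled execution reaching e.
efficient-substitution : {N : ℕ} (P : Proc (Atom N)) (e : OccP P) → Efficient P e →
  (g : OccP P → Λ N) {t : Λ N} → g e ≡ t → ∃ λ ϖ → substP P g ≻ (t ⋆ ϖ)
efficient-substitution P e (ϖ , r) g refl =
  bindS [ at , g ] ϖ ,
  subst (λ M → M ≻ (g e ⋆ bindS [ at , g ] ϖ))
        (bind-labP P [ at , g ] (λ i → refl))
        (bind-exec [ at , g ] r)

lemma6 : (N : ℕ) (P : Proc (Atom N)) → P ∈⊥⊥ →
    Σ (OccP P) (Efficient P) ×
    ((e : OccP P) → Efficient P e →
      ((g : OccP P → Λ N) → g e ≡ at p → substP P g ∈⊥⊥) ×
      ((g : OccP P → Λ N) → g e ≡ at (q zero) →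
        (∃ λ ϖ → substP P g ≻ (at (q zero) ⋆ ϖ)) × ¬ (substP P g ∈⊥⊥)))
lemma6 N P P∈⊥⊥ = efficient-exists P P∈⊥⊥ , λ e e-efficient →
  (λ g ge≡p → efficient-substitution P e e-efficient g ge≡p) ,
  (λ g ge≡q₀ →
    let (ϖ , reaches-q₀) = efficient-substitution P e e-efficient g ge≡q₀
        -- a process reaching q₀ cannot also reach p (determinism)
        not-in-pole : ¬ (substP P g ∈⊥⊥)
        not-in-pole (_ , reaches-p) = q≢p (reached-atom-unique reaches-q₀ reaches-p)
    in (ϖ , reaches-q₀) , not-in-pole)
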